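{- Let $q$ be a prime power and $m\ge1$, $\ell\ge0$ integers. Then the graph $\Gamma_{q,m}(\ell)$ is arc-transitive: for any vertices $x,y,v,w$ with $x-y\in S_{q,m}(\ell)$ and $v-w\in S_{q,m}(\ell)$ there is an automorphism $\psi$ of $\Gamma_{q,m}(\ell)$ with $\psi(x)=v$ and $\psi(y)=w$.
   Context: $S_{q,m}(\ell)=\{x^{q^\ell+1}:x\in\mathbb F_{q^m}^*\}$ and $\Gamma_{q,m}(\ell)$ is the Cayley (di)graph with vertex set $\mathbb F_{q^m}$ and an edge from $x$ to $y$ iff $y-x\in S_{q,m}(\ell)$. An automorphism is a bijection of the vertex set preserving edges. -}

module Defs where

open import Level using (Level; _⊔_)
open import Data.Nat using (ℕ; suc; _^_; _≥_)
import Data.Nat as ℕ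
open import Data.Nat.Primality using (Prime)
open import Data.Fin using (Fin)
open import Data.Product using (Σ; ∃; _×_; _,_)
open import Relation.Nullary using (¬_)
open import Relation.Binary.PropositionalEquality as ≡ using (_≡_)
open import Function.Bundles using (Bijection; _⇔_)
open import Algebra.Bundles using (CommutativeRing; Semiring)
import Algebra.Definitions.RawSemiring as RS

IsPrimePower : ℕ → Set
IsPrimePower q = Σ ℕ λ p → Σ ℕ λ k → Prime p × k ≥ 1 × q ≡ p ^ k

record IsField {c ℓ} (R : CommutativeRing c ℓ) : Set (c ⊔ ℓ) where
  open CommutativeRing R
  field
    0≉1     : ¬ (0# ≈ 1#)
    inverse : ∀ x → ¬ (x ≈ 0#) → ∃ λ y → x * y ≈ 1#

record FiniteFieldOfOrder {c ℓ} (R : CommutativeRing c ℓ) (n : ℕ) : Set (c ⊔ ℓ) where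
  open CommutativeRing R
  field
    isField  : IsField R
    counting : Bijection (≡.setoid (Fin n)) setoid

module _ {c ℓ} (F : CommutativeRing c ℓ) where
  open CommutativeRing F
  open RS (Semiring.rawSemiring semiring) using () renaming (_^_ to _^ᶠ_)

  S : (q l : ℕ) → Carrier → Set (c ⊔ ℓ)
  S q l s = ∃ λ z → ¬ (z ≈ 0#) × s ≈ z ^ᶠ (q ^ l ℕ.+ 1)

  Arc : (q l : ℕ) → Carrier → Carrier → Set (c ⊔ ℓ)
  Arc q l x y = S q l (y - x)

  record Automorphism (q l : ℕ) : Set (c ⊔ ℓ) where
    field
      bij       : Bijection setoid setoid
    open Bijection bij public using (to)
    field
      preserves : ∀ x y → Arc q l x y ⇔ Arc q l (to x) (to y)

-- For nonzero s, t with x - y = s ^ e and v - w = t ^ e, where e = q ^ l + 1, the affine map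
-- z ↦ (t / s) ^ e · (z - x) + v sends x to v and y to w. It multiplies every difference by the
-- e-th power of a unit, and the e-th powers of nonzero elements are closed under multiplication
-- by such a power, so the map preserves arcs in both directions.
module Submission where

open import Defs
open import Data.Nat using (ℕ; zero; suc; _^_; _≥_)
import Data.Nat as ℕ
open import Data.Product using (Σ; ∃; _×_; _,_)
open import Algebra.Bundles using (CommutativeRing; Semiring; Ring)
import Algebra.Definitions.RawSemiring as RawSemiringDefinitions
import Algebra.Properties.Semiring.Exp as SemiringExp
import Algebra.Properties.CommutativeSemiring.Exp as CommutativeSemiringExp
import Algebra.Properties.RingWithoutOne as RingWithoutOneProperties
import Algebra.Properties.Group as GroupProperties
import Algebra.Properties.AbelianGroup as AbelianGroupProperties
import Algebra.Properties.CommutativeSemigroup as CommutativeSemigroupProperties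
open import Relation.Nullary using (¬_)
open import Function.Bundles using (Inverse; mk⇔)
open import Function.Properties.Inverse using (Inverse⇒Bijection)
import Relation.Binary.Reasoning.Setoid as SetoidReasoning

module _ {c ℓ} (F : CommutativeRing c ℓ) where
  open CommutativeRing F
  open RawSemiringDefinitions (Semiring.rawSemiring semiring) using () renaming (_^_ to _^ᶠ_)
  open SemiringExp semiring using (^-congˡ)
  open CommutativeSemiringExp commutativeSemiring using (^-distrib-*)
  open RingWithoutOneProperties (Ring.ringWithoutOne ring) using (-‿distribʳ-*; x[y-z]≈xy-xz)
  open GroupProperties +-group using (//-rightDividesˡ; //-rightDividesʳ; ⁻¹-anti-homo-∙)
  open AbelianGroupProperties +-abelianGroup using (⁻¹-anti-homo‿-)
  open CommutativeSemigroupProperties +-commutativeSemigroup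
    using () renaming (interchange to +-interchange)
  open CommutativeSemigroupProperties *-commutativeSemigroup
    using () renaming (interchange to *-interchange)
  open SetoidReasoning setoid

  [x+z]-[y+z]≈x-y : ∀ x y z → (x + z) - (y + z) ≈ x - y
  [x+z]-[y+z]≈x-y x y z = begin
    (x + z) + - (y + z)    ≈⟨ +-congˡ (⁻¹-anti-homo-∙ y z) ⟩
    (x + z) + (- z + - y)  ≈⟨ +-congˡ (+-comm (- z) (- y)) ⟩
    (x + z) + (- y + - z)  ≈⟨ +-interchange x z (- y) (- z) ⟩
    (x - y) + (z - z)      ≈⟨ +-congˡ (-‿inverseʳ z) ⟩
    (x - y) + 0#           ≈⟨ +-identityʳ (x - y) ⟩
    x - y                  ∎

  [x-z]-[y-z]≈x-y : ∀ x y z → (x - z) - (y - z) ≈ x - y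
  [x-z]-[y-z]≈x-y x y z = [x+z]-[y+z]≈x-y x y (- z)

  ^-inverse : ∀ {a a′} → a * a′ ≈ 1# → ∀ n → a ^ᶠ n * a′ ^ᶠ n ≈ 1#
  ^-inverse aa′≈1 zero = *-identityˡ 1#
  ^-inverse {a} {a′} aa′≈1 (suc n) = begin
    (a * a ^ᶠ n) * (a′ * a′ ^ᶠ n)   ≈⟨ *-interchange a (a ^ᶠ n) a′ (a′ ^ᶠ n) ⟩
    (a * a′) * (a ^ᶠ n * a′ ^ᶠ n)   ≈⟨ *-cong aa′≈1 (^-inverse aa′≈1 n) ⟩
    1# * 1#                        ≈⟨ *-identityˡ 1# ⟩
    1#                             ∎

  inverse-cancelˡ : ∀ {a a′} → a′ * a ≈ 1# → ∀ z → a′ * (a * z) ≈ z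
  inverse-cancelˡ {a} {a′} a′a≈1 z = begin
    a′ * (a * z)  ≈⟨ *-assoc a′ a z ⟨
    (a′ * a) * z  ≈⟨ *-congʳ a′a≈1 ⟩
    1# * z        ≈⟨ *-identityˡ z ⟩
    z             ∎

  unit*nonzero≉0 : ∀ {u u′ z} → u′ * u ≈ 1# → ¬ (z ≈ 0#) → ¬ (u * z ≈ 0#)
  unit*nonzero≉0 {u} {u′} {z} u′u≈1 z≉0 uz≈0 = z≉0 (begin
    z             ≈⟨ inverse-cancelˡ u′u≈1 z ⟨
    u′ * (u * z)  ≈⟨ *-congˡ uz≈0 ⟩
    u′ * 0#       ≈⟨ zeroʳ u′ ⟩
    0#            ∎)

  nonzero-ratio : IsField F → ∀ {s t} → ¬ (s ≈ 0#) → ¬ (t ≈ 0#) →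
                  ∃ λ u → ∃ λ u′ → u * u′ ≈ 1# × u * s ≈ t
  nonzero-ratio isField {s} {t} s≉0 t≉0 with IsField.inverse isField s s≉0
                                           | IsField.inverse isField t t≉0
  ... | s⁻¹ , ss⁻¹≈1 | t⁻¹ , tt⁻¹≈1 = t * s⁻¹ , s * t⁻¹ , uu′≈1 , us≈t
    where
    uu′≈1 : (t * s⁻¹) * (s * t⁻¹) ≈ 1#
    uu′≈1 = begin
      (t * s⁻¹) * (s * t⁻¹)  ≈⟨ *-congˡ (*-comm s t⁻¹) ⟩
      (t * s⁻¹) * (t⁻¹ * s)  ≈⟨ *-interchange t s⁻¹ t⁻¹ s ⟩
      (t * t⁻¹) * (s⁻¹ * s)  ≈⟨ *-cong tt⁻¹≈1 (trans (*-comm s⁻¹ s) ss⁻¹≈1) ⟩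
      1# * 1#                ≈⟨ *-identityˡ 1# ⟩
      1#                     ∎
    us≈t : (t * s⁻¹) * s ≈ t
    us≈t = begin
      (t * s⁻¹) * s  ≈⟨ *-assoc t s⁻¹ s ⟩
      t * (s⁻¹ * s)  ≈⟨ *-congˡ (trans (*-comm s⁻¹ s) ss⁻¹≈1) ⟩
      t * 1#         ≈⟨ *-identityʳ t ⟩
      t              ∎

  S-resp-≈ : ∀ q l {d d′} → d ≈ d′ → S F q l d → S F q l d′
  S-resp-≈ q l d≈d′ (z , z≉0 , d≈zᵉ) = z , z≉0 , trans (sym d≈d′) d≈zᵉ

  S-*-unit^ : ∀ q l {u u′ d} → u′ * u ≈ 1# → S F q l d → S F q l (u ^ᶠ (q ^ l ℕ.+ 1) * d)
  S-*-unit^ q l {u} u′u≈1 (z , z≉0 , d≈zᵉ) =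
    u * z , unit*nonzero≉0 u′u≈1 z≉0 ,
    trans (*-congˡ d≈zᵉ) (sym (^-distrib-* u z (q ^ l ℕ.+ 1)))

  ^-*-scale : ∀ n {u s t d} → u * s ≈ t → d ≈ s ^ᶠ n → u ^ᶠ n * d ≈ t ^ᶠ n
  ^-*-scale n {u} {s} {t} {d} us≈t d≈sⁿ = begin
    u ^ᶠ n * d       ≈⟨ *-congˡ d≈sⁿ ⟩
    u ^ᶠ n * s ^ᶠ n  ≈⟨ ^-distrib-* u s n ⟨
    (u * s) ^ᶠ n     ≈⟨ ^-congˡ n us≈t ⟩
    t ^ᶠ n           ∎

  affine : Carrier → Carrier → Carrier → Carrier → Carrier
  affine a x v z = a * (z - x) + v

  affine-cong : ∀ a x v {z z′} → z ≈ z′ → affine a x v z ≈ affine a x v z′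
  affine-cong a x v z≈z′ = +-congʳ (*-congˡ (+-congʳ z≈z′))

  affine-base : ∀ a x v → affine a x v x ≈ v
  affine-base a x v = begin
    a * (x - x) + v  ≈⟨ +-congʳ (*-congˡ (-‿inverseʳ x)) ⟩
    a * 0# + v       ≈⟨ +-congʳ (zeroʳ a) ⟩
    0# + v           ≈⟨ +-identityˡ v ⟩
    v                ∎

  affine-diff : ∀ a x v y z → affine a x v z - affine a x v y ≈ a * (z - y)
  affine-diff a x v y z = begin
    (a * (z - x) + v) - (a * (y - x) + v)  ≈⟨ [x+z]-[y+z]≈x-y _ _ v ⟩
    a * (z - x) - a * (y - x)              ≈⟨ x[y-z]≈xy-xz a _ _ ⟨
    a * ((z - x) - (y - x))                ≈⟨ *-congˡ ([x-z]-[y-z]≈x-y z y x) ⟩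
    a * (z - y)                            ∎

  affine-target : ∀ {a x y v w} → a * (x - y) ≈ v - w → affine a x v y ≈ w
  affine-target {a} {x} {y} {v} {w} a[x-y]≈v-w = begin
    a * (y - x) + v       ≈⟨ +-congʳ (*-congˡ (⁻¹-anti-homo‿- x y)) ⟨
    a * (- (x - y)) + v   ≈⟨ +-congʳ (-‿distribʳ-* a (x - y)) ⟨
    - (a * (x - y)) + v   ≈⟨ +-congʳ (-‿cong a[x-y]≈v-w) ⟩
    - (v - w) + v         ≈⟨ +-congʳ (⁻¹-anti-homo‿- v w) ⟩
    (w - v) + v           ≈⟨ //-rightDividesˡ v w ⟩
    w                     ∎

  affine-inverseˡ : ∀ {a a′} → a′ * a ≈ 1# → ∀ x v z → affine a′ v x (affine a x v z) ≈ z
  affine-inverseˡ {a} {a′} a′a≈1 x v z = begin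
    a′ * ((a * (z - x) + v) - v) + x  ≈⟨ +-congʳ (*-congˡ (//-rightDividesʳ v _)) ⟩
    a′ * (a * (z - x)) + x            ≈⟨ +-congʳ (inverse-cancelˡ a′a≈1 (z - x)) ⟩
    (z - x) + x                       ≈⟨ //-rightDividesˡ x z ⟩
    z                                 ∎

  affine-Inverse : ∀ {a a′} → a * a′ ≈ 1# → ∀ x v → Inverse setoid setoid
  affine-Inverse {a} {a′} aa′≈1 x v = record
    { to        = affine a x v
    ; from      = affine a′ v x
    ; to-cong   = affine-cong a x v
    ; from-cong = affine-cong a′ v x
    ; inverse   = (λ {z} z≈ → trans (affine-cong a x v z≈) (affine-inverseˡ aa′≈1 v x z))
                , (λ {z} z≈ → trans (affine-cong a′ v x z≈)
                                    (affine-inverseˡ (trans (*-comm a′ a) aa′≈1) x v z))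
    }

  affine-Automorphism : ∀ q l {u u′} → u * u′ ≈ 1# → ∀ x v → Automorphism F q l
  affine-Automorphism q l {u} {u′} uu′≈1 x v = record
    { bij       = Inverse⇒Bijection (affine-Inverse aa′≈1 x v)
    ; preserves = λ y z → mk⇔
        (λ arc → S-resp-≈ q l (sym (affine-diff a x v y z)) (S-*-unit^ q l u′u≈1 arc))
        (λ arc → S-resp-≈ q l (inverse-cancelˡ a′a≈1 (z - y))
                   (S-*-unit^ q l uu′≈1 (S-resp-≈ q l (affine-diff a x v y z) arc)))
    }
    where
    e = q ^ l ℕ.+ 1
    a = u ^ᶠ e
    a′ = u′ ^ᶠ e
    u′u≈1 : u′ * u ≈ 1#
    u′u≈1 = trans (*-comm u′ u) uu′≈1
    aa′≈1 : a * a′ ≈ 1#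
    aa′≈1 = ^-inverse uu′≈1 e
    a′a≈1 : a′ * a ≈ 1#
    a′a≈1 = ^-inverse u′u≈1 e

proposition6p2 : ∀ {c ℓ} (q m l : ℕ) → IsPrimePower q → m ≥ 1 →
    (F : CommutativeRing c ℓ) → FiniteFieldOfOrder F (q ^ m) →
    let open CommutativeRing F in
    ∀ x y v w → S F q l (x - y) → S F q l (v - w) →
    Σ (Automorphism F q l) λ ψ →
    (Automorphism.to ψ x ≈ v) × (Automorphism.to ψ y ≈ w)
proposition6p2 q m l _ _ F finiteField x y v w (s , s≉0 , x-y≈sᵉ) (t , t≉0 , v-w≈tᵉ)
  with nonzero-ratio F (FiniteFieldOfOrder.isField finiteField) s≉0 t≉0
... | u , u′ , uu′≈1 , us≈t =
    affine-Automorphism F q l uu′≈1 x v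
  , affine-base F _ x v
  , affine-target F (CommutativeRing.trans F (^-*-scale F (q ^ l ℕ.+ 1) us≈t x-y≈sᵉ)
                                             (CommutativeRing.sym F v-w≈tᵉ))
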